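{- Let $p$ be an odd prime and $x\in\mathbb{Z}$, and let $A_k(x)=\sum_{j=0}^{k}\binom{k}{j}^2\binom{k+j}{j}^2x^j$ for $k\ge0$. Then $$\frac{1}{p}\sum_{k=0}^{p-1}(-1)^k(2k+1)A_k(x)\equiv\sum_{k=0}^{p-1}\binom{2k}{k}x^k\pmod{p^2}.$$ -}

module Defs where

open import Data.Nat using (ℕ; zero; suc) renaming (_+_ to _+ℕ_; _*_ to _*ℕ_)
open import Data.Nat.Combinatorics using (_C_)
open import Data.Integer using (ℤ; +_; _+_; _*_; _-_; -_; _^_)
open import Data.Integer.Divisibility using (_∣_)

sumBelow : ℕ → (ℕ → ℤ) → ℤ
sumBelow zero    f = + 0
sumBelow (suc n) f = sumBelow n f + f n

sgn : ℕ → ℤ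
sgn k = (- + 1) ^ k

A : ℕ → ℤ → ℤ
A k x = sumBelow (suc k) (λ j →
  + ((k C j) *ℕ (k C j) *ℕ ((k +ℕ j) C j) *ℕ ((k +ℕ j) C j)) * (x ^ j))

_≡_[mod_] : ℤ → ℤ → ℤ → Set
a ≡ b [mod m ] = m ∣ (a - b)

{-# OPTIONS --safe #-}

-- Write A_k(x) = Σ_j B(j,k)² x^j with B(j,k) = C(k,j) C(k+j,j). Products of the B(·,k) linearise,
-- B(j,k) B(m,k) = Σ_{t≤j} γ(j,m,t) B(m+t,k), and Σ_{k<n} (−1)^k (2k+1) B(l,k) telescopes to
-- (−1)^{n−1} n C(n−1,l) C(n+l,l). Taking n = p makes the left-hand side p·q with
-- q = Σ_j x^j Σ_t γ(j,j,t) C(p−1,j+t) C(p+j+t,j+t). Modulo p², C(p−1,l) C(p+l,l) ≡ (−1)^l for l < p,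
-- the terms with j + t ≥ p vanish, and the remaining alternating sum Σ_t (−1)^{j+t} γ(j,j,t) is C(2j,j).
module Submission where

open import Defs
open import Data.Empty using (⊥-elim)
open import Data.Integer using (ℤ; +_; _+_; _*_; _-_; -_; _^_; ∣_∣)
import Data.Integer.Properties as ℤ
open import Data.Integer.Divisibility using () renaming (_∣_ to _∣ᵤ_)
open import Data.Integer.Divisibility.Signed
  using (_∣_; divides; ∣ᵤ⇒∣; ∣⇒∣ᵤ; ∣-refl; ∣m∣n⇒∣m+n; ∣m∣n⇒∣m-n; ∣m⇒∣m*n; ∣n⇒∣m*n)
open import Data.Integer.Tactic.RingSolver using (solve-∀)
open import Data.Nat
  using (ℕ; zero; suc; _≤_; _<_; _≤′_; ≤′-reflexive; ≤′-step; z<s; _!; _∸_; NonZero; nonTrivial⇒n>1)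
  renaming (_*_ to _*ℕ_; _+_ to _+ℕ_)
import Data.Nat.Properties as ℕ
open import Data.Nat.Combinatorics using (_C_; nCk+nC[k+1]≡[n+1]C[k+1]; nC1≡n; nCn≡1; k![n∸k]!∣n!)
open import Data.Nat.Combinatorics.Specification using (k>n⇒nCk≡0; nCk≡n!/k![n-k]!)
open import Data.Nat.Divisibility as ℕ∣ using () renaming (_∣_ to _∣ℕ_)
open import Data.Nat.DivMod using (_/_; m/n*n≡m)
open import Data.Nat.Primality
  using (Prime; euclidsLemma; prime⇒nonZero; prime⇒nonTrivial; prime⇒irreducible)
import Data.Nat.Tactic.RingSolver as ℕ-Solver
open import Algebra.Properties.CommutativeSemigroup ℤ.*-commutativeSemigroup using (x∙yz≈y∙xz)
open import Algebra.Properties.CommutativeSemigroup ℤ.+-commutativeSemigroup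
  using () renaming (x∙yz≈y∙xz to x+[y+z]≈y+[x+z])
open import Data.Product using (Σ; _×_; _,_; ∃)
open import Data.Sum using (_⊎_; inj₁; inj₂)
open import Relation.Nullary using (¬_; yes; no)
open import Relation.Binary.PropositionalEquality
  using (_≡_; _≢_; refl; sym; trans; cong; cong₂; subst; module ≡-Reasoning)

sumBelow-cong< : ∀ n {f g : ℕ → ℤ} → (∀ i → i < n → f i ≡ g i) → sumBelow n f ≡ sumBelow n g
sumBelow-cong< zero    f≡g = refl
sumBelow-cong< (suc n) f≡g =
  cong₂ _+_ (sumBelow-cong< n (λ i i<n → f≡g i (ℕ.m<n⇒m<1+n i<n))) (f≡g n ℕ.≤-refl)

sumBelow-cong : ∀ n {f g : ℕ → ℤ} → (∀ i → f i ≡ g i) → sumBelow n f ≡ sumBelow n g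
sumBelow-cong n f≡g = sumBelow-cong< n (λ i _ → f≡g i)

sumBelow-+ : ∀ n (f g : ℕ → ℤ) → sumBelow n (λ i → f i + g i) ≡ sumBelow n f + sumBelow n g
sumBelow-+ zero    f g = refl
sumBelow-+ (suc n) f g =
  trans (cong (_+ (f n + g n)) (sumBelow-+ n f g)) (shuffle (sumBelow n f) (f n) (sumBelow n g) (g n))
  where
  shuffle : ∀ a b c d → (a + c) + (b + d) ≡ (a + b) + (c + d)
  shuffle = solve-∀

sumBelow-*ˡ : ∀ n c (f : ℕ → ℤ) → sumBelow n (λ i → c * f i) ≡ c * sumBelow n f
sumBelow-*ˡ zero    c f = sym (ℤ.*-zeroʳ c)
sumBelow-*ˡ (suc n) c f =
  trans (cong (_+ (c * f n)) (sumBelow-*ˡ n c f)) (sym (ℤ.*-distribˡ-+ c (sumBelow n f) (f n)))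

sumBelow-neg : ∀ n (f : ℕ → ℤ) → sumBelow n (λ i → - f i) ≡ - sumBelow n f
sumBelow-neg n f = begin
  sumBelow n (λ i → - f i)      ≡⟨ sumBelow-cong n (λ i → sym (ℤ.-1*i≡-i (f i))) ⟩
  sumBelow n (λ i → - + 1 * f i) ≡⟨ sumBelow-*ˡ n (- + 1) f ⟩
  - + 1 * sumBelow n f          ≡⟨ ℤ.-1*i≡-i _ ⟩
  - sumBelow n f                ∎
  where open ≡-Reasoning

sumBelow-- : ∀ n (f g : ℕ → ℤ) → sumBelow n (λ i → f i - g i) ≡ sumBelow n f - sumBelow n g
sumBelow-- n f g =
  trans (sumBelow-+ n f (λ i → - g i)) (cong (_+_ (sumBelow n f)) (sumBelow-neg n g))

sumBelow-suc : ∀ n (f : ℕ → ℤ) → sumBelow (suc n) f ≡ f 0 + sumBelow n (λ i → f (suc i))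
sumBelow-suc zero    f = ℤ.+-comm (+ 0) (f 0)
sumBelow-suc (suc n) f =
  trans (cong (_+ f (suc n)) (sumBelow-suc n f)) (ℤ.+-assoc (f 0) _ (f (suc n)))

sumBelow-zero : ∀ n → sumBelow n (λ _ → + 0) ≡ + 0
sumBelow-zero zero    = refl
sumBelow-zero (suc n) = trans (ℤ.+-identityʳ _) (sumBelow-zero n)

sumBelow-swap : ∀ n m (f : ℕ → ℕ → ℤ) →
  sumBelow n (λ i → sumBelow m (f i)) ≡ sumBelow m (λ j → sumBelow n (λ i → f i j))
sumBelow-swap zero    m f = sym (sumBelow-zero m)
sumBelow-swap (suc n) m f =
  trans (cong (_+ sumBelow m (f n)) (sumBelow-swap n m f))
        (sym (sumBelow-+ m (λ j → sumBelow n (λ i → f i j)) (f n)))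

sumBelow-extend : ∀ {n N} (f : ℕ → ℤ) → n ≤ N → (∀ i → n ≤ i → f i ≡ + 0) →
  sumBelow N f ≡ sumBelow n f
sumBelow-extend {n} f n≤N vanishes = go (ℕ.≤⇒≤′ n≤N)
  where
  go : ∀ {N} → n ≤′ N → sumBelow N f ≡ sumBelow n f
  go (≤′-reflexive refl) = refl
  go (≤′-step {N} n≤′N)  =
    trans (cong₂ _+_ (go n≤′N) (vanishes N (ℕ.≤′⇒≤ n≤′N))) (ℤ.+-identityʳ _)

∣-sumBelow : ∀ n {d} (f : ℕ → ℤ) → (∀ i → i < n → d ∣ f i) → d ∣ sumBelow n f
∣-sumBelow zero    f d∣f = ∣ᵤ⇒∣ (ℕ∣._∣0 _)
∣-sumBelow (suc n) f d∣f =
  ∣m∣n⇒∣m+n (∣-sumBelow n f (λ i i<n → d∣f i (ℕ.m<n⇒m<1+n i<n))) (d∣f n ℕ.≤-refl)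

[k+1]*[n+1]C[k+1]≡[n+1]*nCk : ∀ n k → suc k *ℕ (suc n C suc k) ≡ suc n *ℕ (n C k)
[k+1]*[n+1]C[k+1]≡[n+1]*nCk zero    zero    = refl
[k+1]*[n+1]C[k+1]≡[n+1]*nCk zero    (suc k) = ℕ.*-zeroʳ (suc (suc k))
[k+1]*[n+1]C[k+1]≡[n+1]*nCk (suc n) zero    =
  trans (ℕ.*-identityˡ _) (trans (nC1≡n (suc (suc n))) (sym (ℕ.*-identityʳ _)))
[k+1]*[n+1]C[k+1]≡[n+1]*nCk (suc n) (suc k) = begin
  suc (suc k) *ℕ (suc (suc n) C suc (suc k))
    ≡⟨ cong (suc (suc k) *ℕ_) (sym (nCk+nC[k+1]≡[n+1]C[k+1] (suc n) (suc k))) ⟩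
  suc (suc k) *ℕ (a +ℕ b)
    ≡⟨ expand k a b ⟩
  (suc k *ℕ a +ℕ a) +ℕ suc (suc k) *ℕ b
    ≡⟨ cong₂ (λ u v → (u +ℕ a) +ℕ v) ([k+1]*[n+1]C[k+1]≡[n+1]*nCk n k)
                                     ([k+1]*[n+1]C[k+1]≡[n+1]*nCk n (suc k)) ⟩
  (suc n *ℕ (n C k) +ℕ a) +ℕ suc n *ℕ (n C suc k)
    ≡⟨ collect n (n C k) (n C suc k) a ⟩
  suc n *ℕ ((n C k) +ℕ (n C suc k)) +ℕ a
    ≡⟨ cong (λ u → suc n *ℕ u +ℕ a) (nCk+nC[k+1]≡[n+1]C[k+1] n k) ⟩
  suc n *ℕ a +ℕ a
    ≡⟨ ℕ.+-comm (suc n *ℕ a) a ⟩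
  suc (suc n) *ℕ a ∎
  where
  open ≡-Reasoning
  a = suc n C suc k
  b = suc n C suc (suc k)
  expand : ∀ k a b → suc (suc k) *ℕ (a +ℕ b) ≡ (suc k *ℕ a +ℕ a) +ℕ suc (suc k) *ℕ b
  expand = ℕ-Solver.solve-∀
  collect : ∀ n c d a → (suc n *ℕ c +ℕ a) +ℕ suc n *ℕ d ≡ suc n *ℕ (c +ℕ d) +ℕ a
  collect = ℕ-Solver.solve-∀

-- Opaque, so that unification treats binom n k as an atom instead of unfolding _C_.
opaque
  binom : ℕ → ℕ → ℤ
  binom n k = + (n C k)

  binom≡nCk : ∀ n k → binom n k ≡ + (n C k)
  binom≡nCk n k = refl

binom-zeroʳ : ∀ n → binom n 0 ≡ + 1
binom-zeroʳ n = binom≡nCk n 0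

binom-diag : ∀ n → binom n n ≡ + 1
binom-diag n = trans (binom≡nCk n n) (cong +_ (nCn≡1 n))

binom-vanishes : ∀ {n k} → n < k → binom n k ≡ + 0
binom-vanishes {n} {k} n<k = trans (binom≡nCk n k) (cong +_ (k>n⇒nCk≡0 n<k))

binom-pascal : ∀ n k → binom (suc n) (suc k) ≡ binom n k + binom n (suc k)
binom-pascal n k = begin
  binom (suc n) (suc k)           ≡⟨ binom≡nCk (suc n) (suc k) ⟩
  + (suc n C suc k)               ≡⟨ cong +_ (nCk+nC[k+1]≡[n+1]C[k+1] n k) ⟨
  + (n C k) + + (n C suc k)       ≡⟨ cong₂ _+_ (binom≡nCk n k) (binom≡nCk n (suc k)) ⟨
  binom n k + binom n (suc k)     ∎
  where open ≡-Reasoning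

binom-absorb : ∀ n k → + suc k * binom (suc n) (suc k) ≡ + suc n * binom n k
binom-absorb n k = begin
  + suc k * binom (suc n) (suc k) ≡⟨ cong (+ suc k *_) (binom≡nCk (suc n) (suc k)) ⟩
  + suc k * + (suc n C suc k)     ≡⟨ ℤ.pos-* (suc k) (suc n C suc k) ⟨
  + (suc k *ℕ (suc n C suc k))    ≡⟨ cong +_ ([k+1]*[n+1]C[k+1]≡[n+1]*nCk n k) ⟩
  + (suc n *ℕ (n C k))            ≡⟨ ℤ.pos-* (suc n) (n C k) ⟩
  + suc n * + (n C k)             ≡⟨ cong (+ suc n *_) (binom≡nCk n k) ⟨
  + suc n * binom n k             ∎
  where open ≡-Reasoning

-- In the ring identities, + 1 + N stands for + suc n: the two agree by computation when N = + n,
-- so instances need no rewriting.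
binom-lower-step : ∀ n k → + suc k * binom n (suc k) ≡ (+ n - + k) * binom n k
binom-lower-step n k = begin
  + suc k * binom n (suc k)
    ≡⟨ split (+ k) (binom n k) (binom n (suc k)) ⟩
  + suc k * (binom n k + binom n (suc k)) - + suc k * binom n k
    ≡⟨ cong (λ c → + suc k * c - + suc k * binom n k) (binom-pascal n k) ⟨
  + suc k * binom (suc n) (suc k) - + suc k * binom n k
    ≡⟨ cong (_- + suc k * binom n k) (binom-absorb n k) ⟩
  + suc n * binom n k - + suc k * binom n k
    ≡⟨ factor (+ n) (+ k) (binom n k) ⟩
  (+ n - + k) * binom n k ∎
  where
  open ≡-Reasoning
  split : ∀ K a b → (+ 1 + K) * b ≡ (+ 1 + K) * (a + b) - (+ 1 + K) * a
  split = solve-∀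
  factor : ∀ N K a → (+ 1 + N) * a - (+ 1 + K) * a ≡ (N - K) * a
  factor = solve-∀

binom-upper-step : ∀ n k → + suc n * binom n k ≡ (+ suc n - + k) * binom (suc n) k
binom-upper-step n zero    =
  cong₂ _*_ (sym (ℤ.+-identityʳ (+ suc n))) (trans (binom-zeroʳ n) (sym (binom-zeroʳ (suc n))))
binom-upper-step n (suc k) = begin
  + suc n * binom n (suc k)
    ≡⟨ split (+ n) (binom n k) (binom n (suc k)) ⟩
  + suc n * (binom n k + binom n (suc k)) - + suc n * binom n k
    ≡⟨ cong (λ c → + suc n * c - + suc n * binom n k) (binom-pascal n k) ⟨
  + suc n * binom (suc n) (suc k) - + suc n * binom n k
    ≡⟨ cong (λ c → + suc n * binom (suc n) (suc k) - c) (binom-absorb n k) ⟨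
  + suc n * binom (suc n) (suc k) - + suc k * binom (suc n) (suc k)
    ≡⟨ factor (+ suc n) (+ suc k) (binom (suc n) (suc k)) ⟩
  (+ suc n - + suc k) * binom (suc n) (suc k) ∎
  where
  open ≡-Reasoning
  split : ∀ N a b → (+ 1 + N) * b ≡ (+ 1 + N) * (a + b) - (+ 1 + N) * a
  split = solve-∀
  factor : ∀ N K a → N * a - K * a ≡ (N - K) * a
  factor = solve-∀

+[2n+1]≡n+n+1 : ∀ n → + (2 *ℕ n +ℕ 1) ≡ + n + + n + + 1
+[2n+1]≡n+n+1 n = cong +_ (lemma n)
  where
  lemma : ∀ n → 2 *ℕ n +ℕ 1 ≡ n +ℕ n +ℕ 1
  lemma = ℕ-Solver.solve-∀

B : ℕ → ℕ → ℤ
B l k = binom k l * binom (k +ℕ l) l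

B-suc : ∀ l k → + suc l * + suc l * B (suc l) k ≡ (+ k - + l) * + suc (k +ℕ l) * B l k
B-suc l k = begin
  + suc l * + suc l * B (suc l) k
    ≡⟨ pair (+ suc l) (binom k (suc l)) (binom (k +ℕ suc l) (suc l)) ⟩
  (+ suc l * binom k (suc l)) * (+ suc l * binom (k +ℕ suc l) (suc l))
    ≡⟨ cong₂ _*_ (binom-lower-step k l) upper ⟩
  ((+ k - + l) * binom k l) * (+ suc (k +ℕ l) * binom (k +ℕ l) l)
    ≡⟨ unpair (+ k - + l) (+ suc (k +ℕ l)) (binom k l) (binom (k +ℕ l) l) ⟩
  (+ k - + l) * + suc (k +ℕ l) * B l k ∎
  where
  open ≡-Reasoning
  upper : + suc l * binom (k +ℕ suc l) (suc l) ≡ + suc (k +ℕ l) * binom (k +ℕ l) l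
  upper = trans (cong (λ n → + suc l * binom n (suc l)) (ℕ.+-suc k l)) (binom-absorb (k +ℕ l) l)
  pair : ∀ c a b → c * c * (a * b) ≡ (c * a) * (c * b)
  pair = solve-∀
  unpair : ∀ c d a b → (c * a) * (d * b) ≡ c * d * (a * b)
  unpair = solve-∀

E : ℕ → ℕ → ℤ
E l zero    = + 0
E l (suc m) = + suc m * (binom (suc m +ℕ l) l * binom m l)

E-suc-lower : ∀ l m → E l (suc m) ≡ (+ suc m - + l) * B l (suc m)
E-suc-lower l m = begin
  + suc m * (binom (suc m +ℕ l) l * binom m l)
    ≡⟨ x∙yz≈y∙xz (+ suc m) (binom (suc m +ℕ l) l) (binom m l) ⟩
  binom (suc m +ℕ l) l * (+ suc m * binom m l)
    ≡⟨ cong (binom (suc m +ℕ l) l *_) (binom-upper-step m l) ⟩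
  binom (suc m +ℕ l) l * ((+ suc m - + l) * binom (suc m) l)
    ≡⟨ rotate (binom (suc m +ℕ l) l) (+ suc m - + l) (binom (suc m) l) ⟩
  (+ suc m - + l) * B l (suc m) ∎
  where
  open ≡-Reasoning
  rotate : ∀ a c b → a * (c * b) ≡ c * (b * a)
  rotate = solve-∀

E-suc-upper : ∀ l m → E l (suc m) ≡ + suc (m +ℕ l) * B l m
E-suc-upper l m = begin
  + suc m * (binom (suc m +ℕ l) l * binom m l)
    ≡⟨ cong (λ c → c * (binom (suc m +ℕ l) l * binom m l)) (cancel (+ m) (+ l)) ⟩
  (+ suc (m +ℕ l) - + l) * (binom (suc m +ℕ l) l * binom m l)
    ≡⟨ ℤ.*-assoc (+ suc (m +ℕ l) - + l) _ (binom m l) ⟨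
  (+ suc (m +ℕ l) - + l) * binom (suc (m +ℕ l)) l * binom m l
    ≡⟨ cong (_* binom m l) (binom-upper-step (m +ℕ l) l) ⟨
  + suc (m +ℕ l) * binom (m +ℕ l) l * binom m l
    ≡⟨ swap (+ suc (m +ℕ l)) (binom (m +ℕ l) l) (binom m l) ⟩
  + suc (m +ℕ l) * B l m ∎
  where
  open ≡-Reasoning
  cancel : ∀ M L → + 1 + M ≡ + 1 + M + L - L
  cancel = solve-∀
  swap : ∀ c a b → c * a * b ≡ c * (b * a)
  swap = solve-∀

E-telescope : ∀ l n → E l n + E l (suc n) ≡ + (2 *ℕ n +ℕ 1) * B l n
E-telescope zero    zero rewrite binom-zeroʳ 0 | binom-zeroʳ 1 = refl
E-telescope (suc l) zero rewrite binom-vanishes {0} {suc l} z<s =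
  both-zero (binom (suc (suc l)) (suc l)) (binom (suc l) (suc l))
  where
  both-zero : ∀ a b → + 0 + + 1 * (a * + 0) ≡ + 1 * (+ 0 * b)
  both-zero = solve-∀
E-telescope l (suc m) = begin
  E l (suc m) + E l (suc (suc m))
    ≡⟨ cong₂ _+_ (E-suc-lower l m) (E-suc-upper l (suc m)) ⟩
  (+ suc m - + l) * B l (suc m) + + suc (suc m +ℕ l) * B l (suc m)
    ≡⟨ collect (+ suc m) (+ l) (B l (suc m)) ⟩
  (+ suc m + + suc m + + 1) * B l (suc m)
    ≡⟨ cong (_* B l (suc m)) (+[2n+1]≡n+n+1 (suc m)) ⟨
  + (2 *ℕ suc m +ℕ 1) * B l (suc m) ∎
  where
  open ≡-Reasoning
  collect : ∀ M L b → (M - L) * b + (+ 1 + M + L) * b ≡ (M + M + + 1) * b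
  collect = solve-∀

alternating-sum-B : ∀ l n →
  sumBelow n (λ k → sgn k * + (2 *ℕ k +ℕ 1) * B l k) ≡ sgn (suc n) * E l n
alternating-sum-B l zero    = refl
alternating-sum-B l (suc n) = begin
  sumBelow n (λ k → sgn k * + (2 *ℕ k +ℕ 1) * B l k) + sgn n * + (2 *ℕ n +ℕ 1) * B l n
    ≡⟨ cong (_+ sgn n * + (2 *ℕ n +ℕ 1) * B l n) (alternating-sum-B l n) ⟩
  sgn (suc n) * E l n + sgn n * + (2 *ℕ n +ℕ 1) * B l n
    ≡⟨ cong (_+_ (sgn (suc n) * E l n)) (ℤ.*-assoc (sgn n) (+ (2 *ℕ n +ℕ 1)) (B l n)) ⟩
  sgn (suc n) * E l n + sgn n * (+ (2 *ℕ n +ℕ 1) * B l n)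
    ≡⟨ cong (λ c → sgn (suc n) * E l n + sgn n * c) (E-telescope l n) ⟨
  sgn (suc n) * E l n + sgn n * (E l n + E l (suc n))
    ≡⟨ cancel (sgn n) (E l n) (E l (suc n)) ⟩
  sgn (suc (suc n)) * E l (suc n) ∎
  where
  open ≡-Reasoning
  cancel : ∀ s e₀ e₁ → (- + 1 * s) * e₀ + s * (e₀ + e₁) ≡ (- + 1 * (- + 1 * s)) * e₁
  cancel = solve-∀

γ : ℕ → ℕ → ℕ → ℤ
γ j m t = binom j t * binom (m +ℕ t) j * binom (m +ℕ j) j

γ-zero : ∀ j m → γ j m 0 ≡ B j m
γ-zero j m = begin
  binom j 0 * binom (m +ℕ 0) j * binom (m +ℕ j) j
    ≡⟨ cong₂ (λ c n → c * binom n j * binom (m +ℕ j) j) (binom-zeroʳ j) (ℕ.+-identityʳ m) ⟩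
  + 1 * binom m j * binom (m +ℕ j) j
    ≡⟨ cong (_* binom (m +ℕ j) j) (ℤ.*-identityˡ (binom m j)) ⟩
  B j m ∎
  where open ≡-Reasoning

γ-suc : ∀ j m t →
  + suc j * + suc j * γ (suc j) m (suc t) ≡
    + suc (m +ℕ t) * + suc (m +ℕ t) * γ j m t
    + (+ suc (m +ℕ t) - + j) * + suc (suc (m +ℕ t) +ℕ j) * γ j m (suc t)
γ-suc j m t rewrite ℕ.+-suc m t | ℕ.+-suc m j = begin
  J′ * J′ * (binom (suc j) (suc t) * R * T)
    ≡⟨ cong (λ w → J′ * J′ * (w * R * T)) (binom-pascal j t) ⟩
  J′ * J′ * ((u + v) * R * T)
    ≡⟨ spread J′ (u + v) R T ⟩
  (u + v) * (J′ * R) * (J′ * T)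
    ≡⟨ cong₂ (λ x y → (u + v) * x * y) (binom-lower-step (suc (m +ℕ t)) j) (binom-absorb (m +ℕ j) j) ⟩
  (u + v) * ((N - J) * Q) * (+ suc (m +ℕ j) * S)
    ≡⟨ expand J (+ m) (+ t) u v Q S ⟩
  (N - J) * Q * S * (N * u + (+ 1 + N + J) * v + ((J - + t) * u - + suc t * v))
    ≡⟨ cong (λ z → (N - J) * Q * S * (N * u + (+ 1 + N + J) * v + ((J - + t) * u - z)))
            (binom-lower-step j t) ⟩
  (N - J) * Q * S * (N * u + (+ 1 + N + J) * v + ((J - + t) * u - (J - + t) * u))
    ≡⟨ collect N J (+ t) u v Q S ⟩
  N * u * S * ((N - J) * Q) + (N - J) * (+ 1 + N + J) * (v * Q * S)
    ≡⟨ cong (λ z → N * u * S * z + (N - J) * (+ 1 + N + J) * (v * Q * S))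
            (binom-upper-step (m +ℕ t) j) ⟨
  N * u * S * (N * P) + (N - J) * (+ 1 + N + J) * (v * Q * S)
    ≡⟨ cong (_+ (N - J) * (+ 1 + N + J) * (v * Q * S)) (regroup N u S P) ⟩
  N * N * (u * P * S) + (N - J) * (+ 1 + N + J) * (v * Q * S) ∎
  where
  open ≡-Reasoning
  J = + j
  J′ = + suc j
  N = + suc (m +ℕ t)
  u = binom j t
  v = binom j (suc t)
  P = binom (m +ℕ t) j
  Q = binom (suc (m +ℕ t)) j
  R = binom (suc (m +ℕ t)) (suc j)
  S = binom (m +ℕ j) j
  T = binom (suc (m +ℕ j)) (suc j)
  spread : ∀ c w r s → c * c * (w * r * s) ≡ w * (c * r) * (c * s)
  spread = solve-∀
  expand : ∀ J M T u v Q S →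
    (u + v) * ((+ 1 + M + T - J) * Q) * ((+ 1 + M + J) * S) ≡
    (+ 1 + M + T - J) * Q * S *
      ((+ 1 + M + T) * u + (+ 1 + (+ 1 + M + T) + J) * v + ((J - T) * u - (+ 1 + T) * v))
  expand = solve-∀
  collect : ∀ N J T u v Q S →
    (N - J) * Q * S * (N * u + (+ 1 + N + J) * v + ((J - T) * u - (J - T) * u)) ≡
    N * u * S * ((N - J) * Q) + (N - J) * (+ 1 + N + J) * (v * Q * S)
  collect = solve-∀
  regroup : ∀ N u S P → N * u * S * (N * P) ≡ N * N * (u * P * S)
  regroup = solve-∀

B-zero : ∀ k → B 0 k ≡ + 1
B-zero k = cong₂ _*_ (binom-zeroʳ k) (binom-zeroʳ (k +ℕ 0))

private
  module Linearisation-step (j m k : ℕ) where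

    ρ : ℕ → ℤ
    ρ L = (+ L - + j) * + suc (L +ℕ j) * B L k

    F G : ℕ → ℤ
    F t = γ j m t * (+ suc (m +ℕ t) * + suc (m +ℕ t) * B (suc (m +ℕ t)) k)
    G t = γ j m t * ρ (m +ℕ t)

    -- k(k+1) − j(j+1) = [k(k+1) − L(L+1)] + [L(L+1) − j(j+1)]
    B-split : ∀ L → (+ k - + j) * + suc (k +ℕ j) * B L k ≡ + suc L * + suc L * B (suc L) k + ρ L
    B-split L = trans (split (+ k) (+ j) (+ L) (B L k)) (cong (_+ ρ L) (sym (B-suc L k)))
      where
      split : ∀ K J L b →
        (K - J) * (+ 1 + K + J) * b ≡ (K - L) * (+ 1 + K + L) * b + (L - J) * (+ 1 + L + J) * b
      split = solve-∀

    first-term : + suc j * + suc j * (γ (suc j) m 0 * B (m +ℕ 0) k) ≡ G 0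
    first-term = begin
      + suc j * + suc j * (γ (suc j) m 0 * B (m +ℕ 0) k)
        ≡⟨ cong₂ (λ g n → + suc j * + suc j * (g * B n k)) (γ-zero (suc j) m) (ℕ.+-identityʳ m) ⟩
      + suc j * + suc j * (B (suc j) m * B m k)
        ≡⟨ ℤ.*-assoc (+ suc j * + suc j) (B (suc j) m) (B m k) ⟨
      + suc j * + suc j * B (suc j) m * B m k
        ≡⟨ cong (_* B m k) (B-suc j m) ⟩
      (+ m - + j) * + suc (m +ℕ j) * B j m * B m k
        ≡⟨ regroup ((+ m - + j) * + suc (m +ℕ j)) (B j m) (B m k) ⟩
      B j m * ρ m
        ≡⟨ cong₂ (λ g n → g * ρ n) (γ-zero j m) (ℕ.+-identityʳ m) ⟨
      G 0 ∎
      where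
      open ≡-Reasoning
      regroup : ∀ c b x → c * b * x ≡ b * (c * x)
      regroup = solve-∀

    shifted-term : ∀ t →
      + suc j * + suc j * (γ (suc j) m (suc t) * B (m +ℕ suc t) k) ≡ F t + G (suc t)
    shifted-term t = begin
      + suc j * + suc j * (γ (suc j) m (suc t) * B (m +ℕ suc t) k)
        ≡⟨ cong (λ n → + suc j * + suc j * (γ (suc j) m (suc t) * B n k)) (ℕ.+-suc m t) ⟩
      + suc j * + suc j * (γ (suc j) m (suc t) * B N k)
        ≡⟨ ℤ.*-assoc (+ suc j * + suc j) (γ (suc j) m (suc t)) (B N k) ⟨
      + suc j * + suc j * γ (suc j) m (suc t) * B N k
        ≡⟨ cong (_* B N k) (γ-suc j m t) ⟩
      (+ N * + N * γ j m t + (+ N - + j) * + suc (N +ℕ j) * γ j m (suc t)) * B N k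
        ≡⟨ distribute (+ N * + N) ((+ N - + j) * + suc (N +ℕ j)) (γ j m t) (γ j m (suc t)) (B N k) ⟩
      F t + γ j m (suc t) * ρ N
        ≡⟨ cong (λ n → F t + γ j m (suc t) * ρ n) (ℕ.+-suc m t) ⟨
      F t + G (suc t) ∎
      where
      open ≡-Reasoning
      N = suc (m +ℕ t)
      distribute : ∀ a b g g′ x → (a * g + b * g′) * x ≡ g * (a * x) + g′ * (b * x)
      distribute = solve-∀

    last-vanishes : G (suc j) ≡ + 0
    last-vanishes = begin
      binom j (suc j) * binom (m +ℕ suc j) j * binom (m +ℕ j) j * ρ (m +ℕ suc j)
        ≡⟨ cong (λ c → c * binom (m +ℕ suc j) j * binom (m +ℕ j) j * ρ (m +ℕ suc j))
                (binom-vanishes (ℕ.n<1+n j)) ⟩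
      + 0 * binom (m +ℕ suc j) j * binom (m +ℕ j) j * ρ (m +ℕ suc j)
        ≡⟨ annihilate (binom (m +ℕ suc j) j) (binom (m +ℕ j) j) (ρ (m +ℕ suc j)) ⟩
      + 0 ∎
      where
      open ≡-Reasoning
      annihilate : ∀ a b c → + 0 * a * b * c ≡ + 0
      annihilate = solve-∀

    module _ (IH : B j k * B m k ≡ sumBelow (suc j) (λ t → γ j m t * B (m +ℕ t) k)) where

      lhs : + suc j * + suc j * (B (suc j) k * B m k) ≡ sumBelow (suc j) F + sumBelow (suc j) G
      lhs = begin
        + suc j * + suc j * (B (suc j) k * B m k)
          ≡⟨ ℤ.*-assoc (+ suc j * + suc j) (B (suc j) k) (B m k) ⟨
        + suc j * + suc j * B (suc j) k * B m k
          ≡⟨ cong (_* B m k) (B-suc j k) ⟩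
        K * B j k * B m k
          ≡⟨ ℤ.*-assoc K (B j k) (B m k) ⟩
        K * (B j k * B m k)
          ≡⟨ cong (K *_) IH ⟩
        K * sumBelow (suc j) (λ t → γ j m t * B (m +ℕ t) k)
          ≡⟨ sumBelow-*ˡ (suc j) K (λ t → γ j m t * B (m +ℕ t) k) ⟨
        sumBelow (suc j) (λ t → K * (γ j m t * B (m +ℕ t) k))
          ≡⟨ sumBelow-cong (suc j) split-term ⟩
        sumBelow (suc j) (λ t → F t + G t)
          ≡⟨ sumBelow-+ (suc j) F G ⟩
        sumBelow (suc j) F + sumBelow (suc j) G ∎
        where
        open ≡-Reasoning
        K = (+ k - + j) * + suc (k +ℕ j)
        split-term : ∀ t → K * (γ j m t * B (m +ℕ t) k) ≡ F t + G t
        split-term t = begin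
          K * (γ j m t * B (m +ℕ t) k)  ≡⟨ x∙yz≈y∙xz K (γ j m t) (B (m +ℕ t) k) ⟩
          γ j m t * (K * B (m +ℕ t) k)  ≡⟨ cong (γ j m t *_) (B-split (m +ℕ t)) ⟩
          γ j m t * (W + ρ (m +ℕ t))    ≡⟨ ℤ.*-distribˡ-+ (γ j m t) W (ρ (m +ℕ t)) ⟩
          F t + G t                     ∎
          where
          W = + suc (m +ℕ t) * + suc (m +ℕ t) * B (suc (m +ℕ t)) k

      rhs : + suc j * + suc j * sumBelow (suc (suc j)) (λ t → γ (suc j) m t * B (m +ℕ t) k) ≡
            sumBelow (suc j) F + sumBelow (suc j) G
      rhs = begin
        J² * sumBelow (suc (suc j)) (λ t → γ (suc j) m t * B (m +ℕ t) k)
          ≡⟨ sumBelow-*ˡ (suc (suc j)) J² _ ⟨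
        sumBelow (suc (suc j)) (λ t → J² * (γ (suc j) m t * B (m +ℕ t) k))
          ≡⟨ sumBelow-suc (suc j) _ ⟩
        J² * (γ (suc j) m 0 * B (m +ℕ 0) k)
          + sumBelow (suc j) (λ t → J² * (γ (suc j) m (suc t) * B (m +ℕ suc t) k))
          ≡⟨ cong₂ _+_ first-term (sumBelow-cong (suc j) shifted-term) ⟩
        G 0 + sumBelow (suc j) (λ t → F t + G (suc t))
          ≡⟨ cong (_+_ (G 0)) (sumBelow-+ (suc j) F (λ t → G (suc t))) ⟩
        G 0 + (sumBelow (suc j) F + sumBelow (suc j) (λ t → G (suc t)))
          ≡⟨ x+[y+z]≈y+[x+z] (G 0) (sumBelow (suc j) F) _ ⟩
        sumBelow (suc j) F + (G 0 + sumBelow (suc j) (λ t → G (suc t)))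
          ≡⟨ cong (_+_ (sumBelow (suc j) F)) (sumBelow-suc (suc j) G) ⟨
        sumBelow (suc j) F + (sumBelow (suc j) G + G (suc j))
          ≡⟨ cong (λ g → sumBelow (suc j) F + (sumBelow (suc j) G + g)) last-vanishes ⟩
        sumBelow (suc j) F + (sumBelow (suc j) G + + 0)
          ≡⟨ cong (_+_ (sumBelow (suc j) F)) (ℤ.+-identityʳ _) ⟩
        sumBelow (suc j) F + sumBelow (suc j) G ∎
        where
        open ≡-Reasoning
        J² = + suc j * + suc j

B-product : ∀ j m k → B j k * B m k ≡ sumBelow (suc j) (λ t → γ j m t * B (m +ℕ t) k)
B-product zero m k = begin
  B 0 k * B m k                 ≡⟨ cong (_* B m k) (B-zero k) ⟩
  + 1 * B m k                   ≡⟨ ℤ.+-identityˡ (+ 1 * B m k) ⟨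
  + 0 + + 1 * B m k             ≡⟨ cong₂ (λ g n → + 0 + g * B n k) (trans (γ-zero 0 m) (B-zero m))
                                         (ℕ.+-identityʳ m) ⟨
  + 0 + γ 0 m 0 * B (m +ℕ 0) k  ∎
  where open ≡-Reasoning
B-product (suc j) m k = ℤ.*-cancelˡ-≡ (+ suc j * + suc j) _ _ (trans (lhs IH) (sym (rhs IH)))
  where
  open Linearisation-step j m k
  IH = B-product j m k

A≡sum-B² : ∀ {k N} x → k < N → A k x ≡ sumBelow N (λ j → x ^ j * (B j k * B j k))
A≡sum-B² {k} x k<N = trans (sumBelow-cong (suc k) summand) (sym (sumBelow-extend f k<N vanishes))
  where
  f : ℕ → ℤ
  f j = x ^ j * (B j k * B j k)
  summand : ∀ j → + ((k C j) *ℕ (k C j) *ℕ ((k +ℕ j) C j) *ℕ ((k +ℕ j) C j)) * x ^ j ≡ f j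
  summand j = begin
    + (a *ℕ a *ℕ b *ℕ b) * x ^ j
      ≡⟨ cong (_* x ^ j) (trans (ℤ.pos-* (a *ℕ a *ℕ b) b) (cong (_* + b)
           (trans (ℤ.pos-* (a *ℕ a) b) (cong (_* + b) (ℤ.pos-* a a))))) ⟩
    + a * + a * + b * + b * x ^ j
      ≡⟨ regroup (+ a) (+ b) (x ^ j) ⟩
    x ^ j * (+ a * + b * (+ a * + b))
      ≡⟨ cong₂ (λ α β → x ^ j * (α * β * (α * β))) (binom≡nCk k j) (binom≡nCk (k +ℕ j) j) ⟨
    f j ∎
    where
    open ≡-Reasoning
    a = k C j
    b = (k +ℕ j) C j
    regroup : ∀ a b y → a * a * b * b * y ≡ y * (a * b * (a * b))
    regroup = solve-∀
  vanishes : ∀ j → suc k ≤ j → f j ≡ + 0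
  vanishes j k<j =
    trans (cong (λ c → x ^ j * (c * β * (c * β))) (binom-vanishes k<j)) (annihilate (x ^ j) β)
    where
    β = binom (k +ℕ j) j
    annihilate : ∀ y β → y * (+ 0 * β * (+ 0 * β)) ≡ + 0
    annihilate = solve-∀

alternating-sum-B-product : ∀ n j m →
  sumBelow n (λ k → sgn k * + (2 *ℕ k +ℕ 1) * (B j k * B m k)) ≡
  sgn (suc n) * sumBelow (suc j) (λ t → γ j m t * E (m +ℕ t) n)
alternating-sum-B-product n j m = begin
  sumBelow n (λ k → w k * (B j k * B m k))
    ≡⟨ sumBelow-cong n (λ k → trans (cong (w k *_) (B-product j m k))
                                    (sym (sumBelow-*ˡ (suc j) (w k) (λ t → γ j m t * B (m +ℕ t) k)))) ⟩
  sumBelow n (λ k → sumBelow (suc j) (λ t → w k * (γ j m t * B (m +ℕ t) k)))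
    ≡⟨ sumBelow-swap n (suc j) _ ⟩
  sumBelow (suc j) (λ t → sumBelow n (λ k → w k * (γ j m t * B (m +ℕ t) k)))
    ≡⟨ sumBelow-cong (suc j) inner ⟩
  sumBelow (suc j) (λ t → sgn (suc n) * (γ j m t * E (m +ℕ t) n))
    ≡⟨ sumBelow-*ˡ (suc j) (sgn (suc n)) _ ⟩
  sgn (suc n) * sumBelow (suc j) (λ t → γ j m t * E (m +ℕ t) n) ∎
  where
  open ≡-Reasoning
  w : ℕ → ℤ
  w k = sgn k * + (2 *ℕ k +ℕ 1)
  inner : ∀ t →
    sumBelow n (λ k → w k * (γ j m t * B (m +ℕ t) k)) ≡ sgn (suc n) * (γ j m t * E (m +ℕ t) n)
  inner t = begin
    sumBelow n (λ k → w k * (γ j m t * B (m +ℕ t) k))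
      ≡⟨ sumBelow-cong n (λ k → x∙yz≈y∙xz (w k) (γ j m t) (B (m +ℕ t) k)) ⟩
    sumBelow n (λ k → γ j m t * (w k * B (m +ℕ t) k))
      ≡⟨ sumBelow-*ˡ n (γ j m t) _ ⟩
    γ j m t * sumBelow n (λ k → w k * B (m +ℕ t) k)
      ≡⟨ cong (γ j m t *_) (alternating-sum-B (m +ℕ t) n) ⟩
    γ j m t * (sgn (suc n) * E (m +ℕ t) n)
      ≡⟨ x∙yz≈y∙xz (γ j m t) (sgn (suc n)) (E (m +ℕ t) n) ⟩
    sgn (suc n) * (γ j m t * E (m +ℕ t) n) ∎

sgn-*-sgn : ∀ k → sgn k * sgn k ≡ + 1
sgn-*-sgn zero    = refl
sgn-*-sgn (suc k) = trans (cancel (sgn k)) (sgn-*-sgn k)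
  where
  cancel : ∀ s → (- + 1 * s) * (- + 1 * s) ≡ s * s
  cancel = solve-∀

sgn-even : ∀ r → sgn (r +ℕ r) ≡ + 1
sgn-even r = trans (ℤ.^-distribˡ-+-* (- + 1) r r) (sgn-*-sgn r)

sgn-suc-suc : ∀ k → sgn (suc (suc k)) ≡ sgn k
sgn-suc-suc k = cancel (sgn k)
  where
  cancel : ∀ s → - + 1 * (- + 1 * s) ≡ s
  cancel = solve-∀

alternating-binom-sum-shifted : ∀ j →
  (∀ m → sumBelow (suc j) (λ t → sgn t * binom j t * binom (m +ℕ t) m) ≡ sgn j * binom m j) →
  ∀ m → sumBelow (suc j) (λ t → sgn t * binom j t * binom (m +ℕ suc t) m) ≡
        sgn j * binom (suc m) (suc j)
alternating-binom-sum-shifted j sum-j zero = begin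
  sumBelow (suc j) (λ t → sgn t * binom j t * binom (suc t) 0)
    ≡⟨ sumBelow-cong (suc j) (λ t → cong (sgn t * binom j t *_)
                                      (trans (binom-zeroʳ (suc t)) (sym (binom-zeroʳ t)))) ⟩
  sumBelow (suc j) (λ t → sgn t * binom j t * binom t 0)
    ≡⟨ sum-j 0 ⟩
  sgn j * binom 0 j
    ≡⟨ cong (sgn j *_) (ℤ.+-identityʳ (binom 0 j)) ⟨
  sgn j * (binom 0 j + + 0)
    ≡⟨ cong (λ c → sgn j * (binom 0 j + c)) (binom-vanishes {0} {suc j} z<s) ⟨
  sgn j * (binom 0 j + binom 0 (suc j))
    ≡⟨ cong (sgn j *_) (binom-pascal 0 j) ⟨
  sgn j * binom 1 (suc j) ∎
  where open ≡-Reasoning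
alternating-binom-sum-shifted j sum-j (suc m) = begin
  sumBelow (suc j) (λ t → sgn t * binom j t * binom (suc m +ℕ suc t) (suc m))
    ≡⟨ sumBelow-cong (suc j) split ⟩
  sumBelow (suc j) (λ t → sgn t * binom j t * binom (m +ℕ suc t) m
                         + sgn t * binom j t * binom (suc m +ℕ t) (suc m))
    ≡⟨ sumBelow-+ (suc j) _ _ ⟩
  sumBelow (suc j) (λ t → sgn t * binom j t * binom (m +ℕ suc t) m)
    + sumBelow (suc j) (λ t → sgn t * binom j t * binom (suc m +ℕ t) (suc m))
    ≡⟨ cong₂ _+_ (alternating-binom-sum-shifted j sum-j m) (sum-j (suc m)) ⟩
  sgn j * binom (suc m) (suc j) + sgn j * binom (suc m) j
    ≡⟨ ℤ.*-distribˡ-+ (sgn j) (binom (suc m) (suc j)) (binom (suc m) j) ⟨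
  sgn j * (binom (suc m) (suc j) + binom (suc m) j)
    ≡⟨ cong (sgn j *_) (trans (ℤ.+-comm (binom (suc m) (suc j)) (binom (suc m) j))
                              (sym (binom-pascal (suc m) j))) ⟩
  sgn j * binom (suc (suc m)) (suc j) ∎
  where
  open ≡-Reasoning
  split : ∀ t → sgn t * binom j t * binom (suc m +ℕ suc t) (suc m) ≡
                sgn t * binom j t * binom (m +ℕ suc t) m + sgn t * binom j t * binom (suc m +ℕ t) (suc m)
  split t = begin
    sgn t * binom j t * binom (suc m +ℕ suc t) (suc m)
      ≡⟨ cong (sgn t * binom j t *_) (binom-pascal (m +ℕ suc t) m) ⟩
    sgn t * binom j t * (binom (m +ℕ suc t) m + binom (m +ℕ suc t) (suc m))
      ≡⟨ cong (λ n → sgn t * binom j t * (binom (m +ℕ suc t) m + binom n (suc m))) (ℕ.+-suc m t) ⟩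
    sgn t * binom j t * (binom (m +ℕ suc t) m + binom (suc m +ℕ t) (suc m))
      ≡⟨ ℤ.*-distribˡ-+ (sgn t * binom j t) _ _ ⟩
    sgn t * binom j t * binom (m +ℕ suc t) m + sgn t * binom j t * binom (suc m +ℕ t) (suc m) ∎

alternating-binom-sum : ∀ j m →
  sumBelow (suc j) (λ t → sgn t * binom j t * binom (m +ℕ t) m) ≡ sgn j * binom m j
alternating-binom-sum zero m = begin
  + 0 + + 1 * binom 0 0 * binom (m +ℕ 0) m
    ≡⟨ cong₂ (λ c n → + 0 + + 1 * c * binom n m) (binom-zeroʳ 0) (ℕ.+-identityʳ m) ⟩
  + 0 + + 1 * + 1 * binom m m
    ≡⟨ cong (λ c → + 0 + + 1 * + 1 * c) (binom-diag m) ⟩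
  + 1
    ≡⟨ cong (+ 1 *_) (binom-zeroʳ m) ⟨
  + 1 * binom m 0 ∎
  where open ≡-Reasoning
alternating-binom-sum (suc j) m = begin
  sumBelow (suc (suc j)) (λ t → sgn t * binom (suc j) t * X t)
    ≡⟨ sumBelow-suc (suc j) _ ⟩
  sgn 0 * binom (suc j) 0 * X 0 + sumBelow (suc j) (λ s → sgn (suc s) * binom (suc j) (suc s) * X (suc s))
    ≡⟨ cong₂ (λ c d → sgn 0 * c * X 0 + d) (trans (binom-zeroʳ (suc j)) (sym (binom-zeroʳ j)))
             (trans (sumBelow-cong (suc j) pascal-term) (sumBelow-- (suc j) _ _)) ⟩
  sgn 0 * binom j 0 * X 0 + (sumBelow (suc j) (λ s → sgn (suc s) * binom j (suc s) * X (suc s)) - K)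
    ≡⟨ ℤ.+-assoc (sgn 0 * binom j 0 * X 0) _ (- K) ⟨
  sgn 0 * binom j 0 * X 0 + sumBelow (suc j) (λ s → sgn (suc s) * binom j (suc s) * X (suc s)) - K
    ≡⟨ cong (_- K) (trans (sym (sumBelow-suc (suc j) f))
                          (sumBelow-extend f (ℕ.n≤1+n (suc j)) vanishes)) ⟩
  sumBelow (suc j) f - K
    ≡⟨ cong₂ _-_ (alternating-binom-sum j m)
                 (alternating-binom-sum-shifted j (alternating-binom-sum j) m) ⟩
  sgn j * binom m j - sgn j * binom (suc m) (suc j)
    ≡⟨ cong (λ c → sgn j * binom m j - sgn j * c) (binom-pascal m j) ⟩
  sgn j * binom m j - sgn j * (binom m j + binom m (suc j))
    ≡⟨ cancel (sgn j) (binom m j) (binom m (suc j)) ⟩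
  sgn (suc j) * binom m (suc j) ∎
  where
  open ≡-Reasoning
  X f : ℕ → ℤ
  X t = binom (m +ℕ t) m
  f t = sgn t * binom j t * X t
  K = sumBelow (suc j) (λ s → sgn s * binom j s * X (suc s))
  pascal-term : ∀ s → sgn (suc s) * binom (suc j) (suc s) * X (suc s) ≡
                      sgn (suc s) * binom j (suc s) * X (suc s) - sgn s * binom j s * X (suc s)
  pascal-term s = trans (cong (λ c → sgn (suc s) * c * X (suc s)) (binom-pascal j s))
                        (expand (sgn s) (binom j s) (binom j (suc s)) (X (suc s)))
    where
    expand : ∀ σ a b x → (- + 1 * σ) * (a + b) * x ≡ (- + 1 * σ) * b * x - σ * a * x
    expand = solve-∀
  vanishes : ∀ t → suc j ≤ t → f t ≡ + 0
  vanishes t j<t = trans (cong (λ c → sgn t * c * X t) (binom-vanishes j<t)) (annihilate (sgn t) (X t))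
    where
    annihilate : ∀ σ x → σ * + 0 * x ≡ + 0
    annihilate = solve-∀
  cancel : ∀ σ a b → σ * a - σ * (a + b) ≡ (- + 1 * σ) * b
  cancel = solve-∀

γ-alternating-sum : ∀ j → sumBelow (suc j) (λ t → γ j j t * sgn (j +ℕ t)) ≡ binom (j +ℕ j) j
γ-alternating-sum j = begin
  sumBelow (suc j) (λ t → γ j j t * sgn (j +ℕ t))
    ≡⟨ sumBelow-cong (suc j) (λ t → trans (cong (γ j j t *_) (ℤ.^-distribˡ-+-* (- + 1) j t))
                                         (regroup (binom j t) (binom (j +ℕ t) j) c (sgn j) (sgn t))) ⟩
  sumBelow (suc j) (λ t → c * sgn j * (sgn t * binom j t * binom (j +ℕ t) j))
    ≡⟨ sumBelow-*ˡ (suc j) (c * sgn j) _ ⟩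
  c * sgn j * sumBelow (suc j) (λ t → sgn t * binom j t * binom (j +ℕ t) j)
    ≡⟨ cong (c * sgn j *_) (alternating-binom-sum j j) ⟩
  c * sgn j * (sgn j * binom j j)
    ≡⟨ cong (λ d → c * sgn j * (sgn j * d)) (binom-diag j) ⟩
  c * sgn j * (sgn j * + 1)
    ≡⟨ regroup′ c (sgn j) ⟩
  c * (sgn j * sgn j)
    ≡⟨ cong (c *_) (sgn-*-sgn j) ⟩
  c * + 1
    ≡⟨ ℤ.*-identityʳ c ⟩
  c ∎
  where
  open ≡-Reasoning
  c = binom (j +ℕ j) j
  regroup : ∀ a b c s t → a * b * c * (s * t) ≡ c * s * (t * a * b)
  regroup = solve-∀
  regroup′ : ∀ c s → c * s * (s * + 1) ≡ c * (s * s)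
  regroup′ = solve-∀

*-pres-∣ : ∀ {a b x y} → a ∣ x → b ∣ y → a * b ∣ x * y
*-pres-∣ {a} {b} (divides q refl) (divides r refl) = divides (q * r) (regroup q a r b)
  where
  regroup : ∀ q a r b → q * a * (r * b) ≡ q * r * (a * b)
  regroup = solve-∀

n∣n! : ∀ n .{{_ : NonZero n}} → n ∣ℕ n !
n∣n! (suc n) = ℕ∣.m∣m*n (n !)

module _ {p : ℕ} (p-prime : Prime p) where

  prime∤! : ∀ {l} → l < p → ¬ (p ∣ℕ l !)
  prime∤! {zero}  _   p∣1 = ℕ.<⇒≢ (nonTrivial⇒n>1 p {{prime⇒nonTrivial p-prime}}) (sym (ℕ∣.∣1⇒≡1 p∣1))
  prime∤! {suc l} l<p p∣l! with euclidsLemma (suc l) (l !) p-prime p∣l!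
  ... | inj₁ p∣1+l = ℕ.<⇒≱ l<p (ℕ∣.∣⇒≤ p∣1+l)
  ... | inj₂ p∣l!  = prime∤! (ℕ.<-trans (ℕ.n<1+n l) l<p) p∣l!

  prime∣binom : ∀ {a b} → a < p → b < p → p ≤ a +ℕ b → p ∣ℕ (a +ℕ b) C a
  prime∣binom {a} {b} a<p b<p p≤a+b with euclidsLemma ((a +ℕ b) C a) (a ! *ℕ b !) p-prime p∣C*a!b!
    where
    C*a!b!≡[a+b]! : ((a +ℕ b) C a) *ℕ (a ! *ℕ b !) ≡ (a +ℕ b) !
    C*a!b!≡[a+b]! = begin
      ((a +ℕ b) C a) *ℕ (a ! *ℕ b !)
        ≡⟨ cong (λ n → ((a +ℕ b) C a) *ℕ (a ! *ℕ n !)) (ℕ.m+n∸m≡n a b) ⟨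
      ((a +ℕ b) C a) *ℕ (a ! *ℕ ((a +ℕ b) ∸ a) !)
        ≡⟨ cong (_*ℕ (a ! *ℕ ((a +ℕ b) ∸ a) !)) (nCk≡n!/k![n-k]! (ℕ.m≤m+n a b)) ⟩
      ((a +ℕ b) ! / (a ! *ℕ ((a +ℕ b) ∸ a) !)) {{ℕ._!*_!≢0 a ((a +ℕ b) ∸ a)}} *ℕ (a ! *ℕ ((a +ℕ b) ∸ a) !)
        ≡⟨ m/n*n≡m {{ℕ._!*_!≢0 a ((a +ℕ b) ∸ a)}} (k![n∸k]!∣n! (ℕ.m≤m+n a b)) ⟩
      (a +ℕ b) ! ∎
      where open ≡-Reasoning
    p∣C*a!b! : p ∣ℕ ((a +ℕ b) C a) *ℕ (a ! *ℕ b !)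
    p∣C*a!b! = subst (p ∣ℕ_) (sym C*a!b!≡[a+b]!)
                 (ℕ∣.∣-trans (n∣n! p {{prime⇒nonZero p-prime}}) (ℕ∣.m≤n⇒m!∣n! p≤a+b))
  ... | inj₁ p∣C = p∣C
  ... | inj₂ p∣a!b! with euclidsLemma (a !) (b !) p-prime p∣a!b!
  ...   | inj₁ p∣a! = ⊥-elim (prime∤! a<p p∣a!)
  ...   | inj₂ p∣b! = ⊥-elim (prime∤! b<p p∣b!)

  prime∣-cancelˡ : ∀ {u n} → ¬ (p ∣ℕ u) → p ∣ℕ u *ℕ n → p ∣ℕ n
  prime∣-cancelˡ {u} {n} p∤u p∣un with euclidsLemma u n p-prime p∣un
  ... | inj₁ p∣u = ⊥-elim (p∤u p∣u)
  ... | inj₂ p∣n = p∣n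

  prime²∣-cancelˡ : ∀ {u n} → ¬ (p ∣ℕ u) → p *ℕ p ∣ℕ u *ℕ n → p *ℕ p ∣ℕ n
  prime²∣-cancelˡ {u} p∤u p²∣un with prime∣-cancelˡ p∤u (ℕ∣.∣-trans (ℕ∣.m∣m*n p) p²∣un)
  ... | ℕ∣.divides q refl = ℕ∣.*-monoˡ-∣ p p∣q
    where
    p∣uq : p ∣ℕ u *ℕ q
    p∣uq = ℕ∣.*-cancelʳ-∣ p {{prime⇒nonZero p-prime}}
             (subst (p *ℕ p ∣ℕ_) (sym (ℕ.*-assoc u q p)) p²∣un)
    p∣q : p ∣ℕ q
    p∣q = prime∣-cancelˡ p∤u p∣uq

D : ℕ → ℕ → ℤ
D m l = binom (suc m +ℕ l) l * binom m l

-- (m − l)(m + l + 2) = (m + 1)² − (l + 1)², so modulo (m + 1)² the product of the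
-- falling factorial m(m−1)⋯(m−l+1) and the rising one (m+2)⋯(m+l+1) is (−1)ˡ(l!)².
[m+1]²∣[l!]²[D-sgn] : ∀ m l → + suc m * + suc m ∣ + (l !) * + (l !) * (D m l - sgn l)
[m+1]²∣[l!]²[D-sgn] m l = subst (+ suc m * + suc m ∣_) (factor l) (falling*rising l)
  where
  falling rising : ℕ → ℤ
  falling l = binom m l * + (l !)
  rising  l = binom (suc m +ℕ l) l * + (l !)

  falling-suc : ∀ l → falling (suc l) ≡ (+ m - + l) * falling l
  falling-suc l = begin
    binom m (suc l) * + (suc l !)        ≡⟨ cong (binom m (suc l) *_) (ℤ.pos-* (suc l) (l !)) ⟩
    binom m (suc l) * (+ suc l * + (l !)) ≡⟨ regroup (binom m (suc l)) (+ suc l) (+ (l !)) ⟩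
    + suc l * binom m (suc l) * + (l !)   ≡⟨ cong (_* + (l !)) (binom-lower-step m l) ⟩
    (+ m - + l) * binom m l * + (l !)     ≡⟨ ℤ.*-assoc (+ m - + l) (binom m l) (+ (l !)) ⟩
    (+ m - + l) * falling l               ∎
    where
    open ≡-Reasoning
    regroup : ∀ c s f → c * (s * f) ≡ s * c * f
    regroup = solve-∀

  rising-suc : ∀ l → rising (suc l) ≡ + suc (suc m +ℕ l) * rising l
  rising-suc l = begin
    binom (suc m +ℕ suc l) (suc l) * + (suc l !)
      ≡⟨ cong₂ (λ n f → binom n (suc l) * f) (ℕ.+-suc (suc m) l) (ℤ.pos-* (suc l) (l !)) ⟩
    binom (suc (suc m +ℕ l)) (suc l) * (+ suc l * + (l !))
      ≡⟨ regroup (binom (suc (suc m +ℕ l)) (suc l)) (+ suc l) (+ (l !)) ⟩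
    + suc l * binom (suc (suc m +ℕ l)) (suc l) * + (l !)
      ≡⟨ cong (_* + (l !)) (binom-absorb (suc m +ℕ l) l) ⟩
    + suc (suc m +ℕ l) * binom (suc m +ℕ l) l * + (l !)
      ≡⟨ ℤ.*-assoc (+ suc (suc m +ℕ l)) (binom (suc m +ℕ l) l) (+ (l !)) ⟩
    + suc (suc m +ℕ l) * rising l ∎
    where
    open ≡-Reasoning
    regroup : ∀ c s f → c * (s * f) ≡ s * c * f
    regroup = solve-∀

  falling*rising : ∀ l → + suc m * + suc m ∣ falling l * rising l - sgn l * + (l !) * + (l !)
  falling*rising zero = subst (+ suc m * + suc m ∣_) (sym zero-case) (∣ᵤ⇒∣ (ℕ∣._∣0 _))
    where
    zero-case : falling 0 * rising 0 - + 1 * + 1 * + 1 ≡ + 0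
    zero-case = cong₂ (λ a b → a * + 1 * (b * + 1) - + 1) (binom-zeroʳ m) (binom-zeroʳ (suc m +ℕ 0))
  falling*rising (suc l) =
    subst (+ suc m * + suc m ∣_) (sym step)
      (∣m∣n⇒∣m-n (∣m⇒∣m*n (falling l * rising l) ∣-refl)
                 (∣n⇒∣m*n (+ suc l * + suc l) (falling*rising l)))
    where
    step : falling (suc l) * rising (suc l) - sgn (suc l) * + (suc l !) * + (suc l !) ≡
           + suc m * + suc m * (falling l * rising l)
             - + suc l * + suc l * (falling l * rising l - sgn l * + (l !) * + (l !))
    step = begin
      falling (suc l) * rising (suc l) - sgn (suc l) * + (suc l !) * + (suc l !)
        ≡⟨ cong₂ (λ a b → a * b - sgn (suc l) * + (suc l !) * + (suc l !)) (falling-suc l) (rising-suc l) ⟩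
      (+ m - + l) * falling l * (+ suc (suc m +ℕ l) * rising l) - sgn (suc l) * + (suc l !) * + (suc l !)
        ≡⟨ cong (λ f → (+ m - + l) * falling l * (+ suc (suc m +ℕ l) * rising l) - sgn (suc l) * f * f)
                (ℤ.pos-* (suc l) (l !)) ⟩
      (+ m - + l) * falling l * (+ suc (suc m +ℕ l) * rising l)
        - sgn (suc l) * (+ suc l * + (l !)) * (+ suc l * + (l !))
        ≡⟨ difference-of-squares (+ m) (+ l) (falling l) (rising l) (+ (l !)) (sgn l) ⟩
      + suc m * + suc m * (falling l * rising l)
        - + suc l * + suc l * (falling l * rising l - sgn l * + (l !) * + (l !)) ∎
      where
      open ≡-Reasoning
      difference-of-squares : ∀ M L f r c s →
        (M - L) * f * ((+ 1 + (+ 1 + M) + L) * r) - (- + 1 * s) * ((+ 1 + L) * c) * ((+ 1 + L) * c) ≡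
        (+ 1 + M) * (+ 1 + M) * (f * r) - (+ 1 + L) * (+ 1 + L) * (f * r - s * c * c)
      difference-of-squares = solve-∀

  factor : ∀ l → falling l * rising l - sgn l * + (l !) * + (l !) ≡ + (l !) * + (l !) * (D m l - sgn l)
  factor l = regroup (binom m l) (binom (suc m +ℕ l) l) (+ (l !)) (sgn l)
    where
    regroup : ∀ a b c s → a * c * (b * c) - s * c * c ≡ c * c * (b * a - s)
    regroup = solve-∀

D≡sgn-mod-p² : ∀ {m} → Prime (suc m) → ∀ {l} → l < suc m → + suc m * + suc m ∣ D m l - sgn l
D≡sgn-mod-p² {m} p-prime {l} l<p =
  ∣ᵤ⇒∣ (prime²∣-cancelˡ p-prime p∤l! (prime²∣-cancelˡ p-prime p∤l! p²∣l!l!X))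
  where
  X = D m l - sgn l
  p∤l! = prime∤! p-prime l<p
  p²∣l!l!X : suc m *ℕ suc m ∣ℕ l ! *ℕ (l ! *ℕ ∣ X ∣)
  p²∣l!l!X = subst (suc m *ℕ suc m ∣ℕ_) abs-eq (∣⇒∣ᵤ ([m+1]²∣[l!]²[D-sgn] m l))
    where
    abs-eq : ∣ + (l !) * + (l !) * X ∣ ≡ l ! *ℕ (l ! *ℕ ∣ X ∣)
    abs-eq = begin
      ∣ + (l !) * + (l !) * X ∣         ≡⟨ ℤ.abs-* (+ (l !) * + (l !)) X ⟩
      ∣ + (l !) * + (l !) ∣ *ℕ ∣ X ∣    ≡⟨ cong (_*ℕ ∣ X ∣) (ℤ.abs-* (+ (l !)) (+ (l !))) ⟩
      l ! *ℕ l ! *ℕ ∣ X ∣               ≡⟨ ℕ.*-assoc (l !) (l !) ∣ X ∣ ⟩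
      l ! *ℕ (l ! *ℕ ∣ X ∣)             ∎
      where open ≡-Reasoning

Q : ℕ → ℕ → ℤ
Q m j = sumBelow (suc j) (λ t → γ j j t * D m (j +ℕ t))

alternating-sum-B² : ∀ {m} → sgn m ≡ + 1 → ∀ j →
  sumBelow (suc m) (λ k → sgn k * + (2 *ℕ k +ℕ 1) * (B j k * B j k)) ≡ + suc m * Q m j
alternating-sum-B² {m} m-even j = begin
  sumBelow (suc m) (λ k → sgn k * + (2 *ℕ k +ℕ 1) * (B j k * B j k))
    ≡⟨ alternating-sum-B-product (suc m) j j ⟩
  sgn (suc (suc m)) * sumBelow (suc j) (λ t → γ j j t * (+ suc m * D m (j +ℕ t)))
    ≡⟨ cong₂ _*_ (trans (sgn-suc-suc m) m-even)
                 (sumBelow-cong (suc j) (λ t → x∙yz≈y∙xz (γ j j t) (+ suc m) (D m (j +ℕ t)))) ⟩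
  + 1 * sumBelow (suc j) (λ t → + suc m * (γ j j t * D m (j +ℕ t)))
    ≡⟨ ℤ.*-identityˡ _ ⟩
  sumBelow (suc j) (λ t → + suc m * (γ j j t * D m (j +ℕ t)))
    ≡⟨ sumBelow-*ˡ (suc j) (+ suc m) _ ⟩
  + suc m * Q m j ∎
  where
  open ≡-Reasoning

module _ {m : ℕ} (p-prime : Prime (suc m)) where

  private
    p = suc m
    p² = + p * + p

  -- For j + t ≥ p both C(j+t, j) and C(2j, j) are divisible by p, so γ j j t is divisible by p².
  Q≡central-binom : ∀ {j} → j < p → p² ∣ Q m j - binom (j +ℕ j) j
  Q≡central-binom {j} j<p = subst (p² ∣_) sum-eq (∣-sumBelow (suc j) _ term)
    where
    sum-eq : sumBelow (suc j) (λ t → γ j j t * (D m (j +ℕ t) - sgn (j +ℕ t))) ≡ Q m j - binom (j +ℕ j) j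
    sum-eq = begin
      sumBelow (suc j) (λ t → γ j j t * (D m (j +ℕ t) - sgn (j +ℕ t)))
        ≡⟨ sumBelow-cong (suc j) (λ t → distrib (γ j j t) (D m (j +ℕ t)) (sgn (j +ℕ t))) ⟩
      sumBelow (suc j) (λ t → γ j j t * D m (j +ℕ t) - γ j j t * sgn (j +ℕ t))
        ≡⟨ sumBelow-- (suc j) _ _ ⟩
      Q m j - sumBelow (suc j) (λ t → γ j j t * sgn (j +ℕ t))
        ≡⟨ cong (_-_ (Q m j)) (γ-alternating-sum j) ⟩
      Q m j - binom (j +ℕ j) j ∎
      where
      open ≡-Reasoning
      distrib : ∀ g d s → g * (d - s) ≡ g * d - g * s
      distrib = solve-∀
    toℤ : ∀ {n k} → p ∣ℕ n C k → + p ∣ binom n k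
    toℤ {n} {k} p∣C = subst (+ p ∣_) (sym (binom≡nCk n k)) (∣ᵤ⇒∣ p∣C)
    term : ∀ t → t < suc j → p² ∣ γ j j t * (D m (j +ℕ t) - sgn (j +ℕ t))
    term t t≤j with j +ℕ t ℕ.<? p
    ... | yes j+t<p = ∣n⇒∣m*n (γ j j t) (D≡sgn-mod-p² p-prime j+t<p)
    ... | no  j+t≮p = ∣m⇒∣m*n (D m (j +ℕ t) - sgn (j +ℕ t))
                        (subst (p² ∣_) (sym (ℤ.*-assoc (binom j t) _ _))
                          (∣n⇒∣m*n (binom j t) (*-pres-∣ (toℤ (prime∣binom p-prime j<p t<p p≤j+t))
                                                         (toℤ (prime∣binom p-prime j<p j<p p≤j+j)))))
      where
      t<p = ℕ.≤-trans t≤j j<p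
      p≤j+t = ℕ.≮⇒≥ j+t≮p
      p≤j+j = ℕ.≤-trans p≤j+t (ℕ.+-monoʳ-≤ j (ℕ.≤-pred t≤j))

  odd-prime-case : sgn m ≡ + 1 → (x : ℤ) →
    Σ ℤ (λ q → (sumBelow p (λ k → sgn k * (+ (2 *ℕ k +ℕ 1)) * A k x) ≡ + p * q)
             × (q ≡ sumBelow p (λ k → + ((2 *ℕ k) C k) * (x ^ k)) [mod (+ p) ^ 2 ]))
  odd-prime-case m-even x = q , sum≡p*q , subst (_∣ᵤ q - target) (sym p²≡p^2) (∣⇒∣ᵤ p²∣q-target)
    where
    q = sumBelow p (λ j → x ^ j * Q m j)
    target = sumBelow p (λ k → + ((2 *ℕ k) C k) * (x ^ k))
    w : ℕ → ℤ
    w k = sgn k * + (2 *ℕ k +ℕ 1)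

    sum≡p*q : sumBelow p (λ k → w k * A k x) ≡ + p * q
    sum≡p*q = begin
      sumBelow p (λ k → w k * A k x)
        ≡⟨ sumBelow-cong< p (λ k k<p → trans (cong (w k *_) (A≡sum-B² x k<p))
                                             (sym (sumBelow-*ˡ p (w k) _))) ⟩
      sumBelow p (λ k → sumBelow p (λ j → w k * (x ^ j * (B j k * B j k))))
        ≡⟨ sumBelow-swap p p _ ⟩
      sumBelow p (λ j → sumBelow p (λ k → w k * (x ^ j * (B j k * B j k))))
        ≡⟨ sumBelow-cong p (λ j → trans (sumBelow-cong p (λ k → x∙yz≈y∙xz (w k) (x ^ j) _))
                                        (sumBelow-*ˡ p (x ^ j) _)) ⟩
      sumBelow p (λ j → x ^ j * sumBelow p (λ k → w k * (B j k * B j k)))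
        ≡⟨ sumBelow-cong p (λ j → trans (cong (x ^ j *_) (alternating-sum-B² m-even j))
                                        (x∙yz≈y∙xz (x ^ j) (+ p) (Q m j))) ⟩
      sumBelow p (λ j → + p * (x ^ j * Q m j))
        ≡⟨ sumBelow-*ˡ p (+ p) _ ⟩
      + p * q ∎
      where
      open ≡-Reasoning

    p²∣q-target : p² ∣ q - target
    p²∣q-target = subst (p² ∣_) sum-eq
      (∣-sumBelow p _ (λ j j<p → ∣n⇒∣m*n (x ^ j) (Q≡central-binom j<p)))
      where
      central : ∀ j → binom (j +ℕ j) j ≡ + ((2 *ℕ j) C j)
      central j = trans (binom≡nCk (j +ℕ j) j) (cong (λ n → + ((j +ℕ n) C j)) (sym (ℕ.+-identityʳ j)))
      sum-eq : sumBelow p (λ j → x ^ j * (Q m j - binom (j +ℕ j) j)) ≡ q - target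
      sum-eq = trans (sumBelow-cong p (λ j → trans (distrib (x ^ j) (Q m j) (binom (j +ℕ j) j))
                                                   (cong (λ c → x ^ j * Q m j - c * x ^ j) (central j))))
                     (sumBelow-- p _ _)
        where
        distrib : ∀ y a c → y * (a - c) ≡ y * a - c * y
        distrib = solve-∀

    p²≡p^2 : (+ p) ^ 2 ≡ p²
    p²≡p^2 = cong (+ p *_) (ℤ.*-identityʳ (+ p))

even⊎odd : ∀ n → (∃ λ r → n ≡ r +ℕ r) ⊎ (∃ λ r → n ≡ suc (r +ℕ r))
even⊎odd zero = inj₁ (0 , refl)
even⊎odd (suc n) with even⊎odd n
... | inj₁ (r , refl) = inj₂ (r , refl)
... | inj₂ (r , refl) = inj₁ (suc r , cong suc (sym (ℕ.+-suc r r)))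

even-prime≡2 : ∀ {r} → Prime (r +ℕ r) → r +ℕ r ≡ 2
even-prime≡2 {r} p-prime with prime⇒irreducible p-prime (ℕ∣.divides r r+r≡r*2)
  where
  r+r≡r*2 : r +ℕ r ≡ r *ℕ 2
  r+r≡r*2 = trans (cong (r +ℕ_) (sym (ℕ.+-identityʳ r))) (ℕ.*-comm 2 r)
... | inj₁ ()
... | inj₂ 2≡r+r = sym 2≡r+r

theorem2p2 : (p : ℕ) → Prime p → p ≢ 2 → (x : ℤ) →
    Σ ℤ (λ q →
      (sumBelow p (λ k → sgn k * (+ (2 *ℕ k +ℕ 1)) * A k x) ≡ + p * q)
      × (q ≡ sumBelow p (λ k → + ((2 *ℕ k) C k) * (x ^ k)) [mod (+ p) ^ 2 ]))
theorem2p2 p p-prime p≢2 x with even⊎odd p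
... | inj₁ (r , refl) = ⊥-elim (p≢2 (even-prime≡2 {r} p-prime))
... | inj₂ (r , refl) = odd-prime-case p-prime (sgn-even r) x
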